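{- If a collection $\mathcal C$ is generatable in the limit without repetition, then $\mathcal C$ is generatable in the limit with repetitions.
   Context: A language is an infinite subset of a countably infinite universe $U$; a collection is a set of languages. A generator is an arbitrary function $G$ from finite sequences in $U$ to $U$, with output $z_t=G(x_0,\dots,x_t)$; $S_t=\{x_0,\dots,x_t\}$. Generation in the limit without repetition: for every $K\in\mathcal C$ and every infinite sequence $x_0,x_1,\dots$ of pairwise distinct elements of $K$ containing every element of $K$, there is $t^\star$ with $z_t\in K\setminus S_t$ for all $t\ge t^\star$. Generation in the limit with repetitions: for every $K\in\mathcal C$ and every sequence $x_0,x_1,\dots$ (repetitions allowed) with $\bigcup_t\{x_t\}=K$, there is $t^\star$ with $z_t\in K\setminus S_t$ for all $t\ge t^\star$. A collection has the property if some $G$ achieves it. -}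

module Defs where

open import Level using (Level; suc; zero)
open import Data.Nat using (ℕ; _≥_)
open import Data.List using (List; []; _∷_; _∷ʳ_)
open import Data.Product using (Σ; _×_; ∃)
open import Relation.Binary.PropositionalEquality using (_≡_)
open import Relation.Nullary using (¬_)
open import Function.Bundles using (_↔_)

Subset : Set → Set₁
Subset U = U → Set

Collection : Set → Set₂
Collection U = Subset U → Set₁

data _∈L_ {U : Set} (x : U) : List U → Set where
  here  : ∀ {xs} → x ∈L (x ∷ xs)
  there : ∀ {y xs} → x ∈L xs → x ∈L (y ∷ xs)

-- K is infinite: no finite list exhausts it (constructive reading).
Infinite : {U : Set} → Subset U → Set
Infinite {U} K = (l : List U) → Σ U (λ x → K x × ¬ (x ∈L l))

IsCollectionOfLanguages : {U : Set} → Collection U → Set₁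
IsCollectionOfLanguages {U} C = (K : Subset U) → C K → Infinite K

prefix : {U : Set} → (ℕ → U) → ℕ → List U
prefix x ℕ.zero    = x ℕ.zero ∷ []
prefix x (ℕ.suc t) = prefix x t ∷ʳ x (ℕ.suc t)

Generator : Set → Set
Generator U = List U → U

Enumerates : {U : Set} → Subset U → (ℕ → U) → Set
Enumerates {U} K x = ((t : ℕ) → K (x t)) × ((y : U) → K y → Σ ℕ (λ t → x t ≡ y))

Distinct : {U : Set} → (ℕ → U) → Set
Distinct x = (i j : ℕ) → x i ≡ x j → i ≡ j

EventuallyGenerates : {U : Set} → Generator U → Subset U → (ℕ → U) → Set
EventuallyGenerates G K x =
  Σ ℕ (λ t⋆ → (t : ℕ) → t ≥ t⋆ →
    K (G (prefix x t)) × ¬ (G (prefix x t) ∈L prefix x t))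

GeneratableWithoutRepetition : {U : Set} → Collection U → Set₁
GeneratableWithoutRepetition {U} C =
  Σ (Generator U) (λ G → (K : Subset U) → C K → (x : ℕ → U) →
     Distinct x → Enumerates K x → EventuallyGenerates G K x)

GeneratableWithRepetitions : {U : Set} → Collection U → Set₁
GeneratableWithRepetitions {U} C =
  Σ (Generator U) (λ G → (K : Subset U) → C K → (x : ℕ → U) →
     Enumerates K x → EventuallyGenerates G K x)

-- Given an enumeration x of K with repetitions, feed G the distinct elements of the
-- prefix in order of first appearance. These deduplicated prefixes form a chain of
-- lists, each extending the previous one by at most one element, and since K is
-- infinite they grow without bound. Their limit y is therefore a repetition-free
-- enumeration of K, on which G eventually succeeds; and at every time t the
-- deduplicated prefix of x is a prefix of y whose length tends to infinity and which
-- has the same elements as the prefix of x, so that success transfers back to x.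
module Submission where

open import Defs
open import Data.Nat using (ℕ; zero; suc; _≤_; _<_; _≥_; _⊔_; z≤n; z<s; s<s; _≤′_; ≤′-refl; ≤′-step)
open import Data.Nat.Properties
  using (_≟_; _<?_; ≤-trans; ≤-reflexive; ≤-antisym; ≤-pred; <-≤-trans; n≤1+n; m≤m⊔n; m≤n⊔m;
         m≤m+n; m<m+n; n<1+n; ≮⇒≥; <⇒≱; <-irrefl; <-cmp; ≤⇒≤′)
open import Data.List using (List; []; _∷_; _∷ʳ_; _++_; [_]; length; foldl; applyUpTo)
open import Data.List.Properties using (++-assoc; ++-identityʳ; length-++; length-++-comm; applyUpTo-∷ʳ; foldl-∷ʳ; ∷ʳ-injective)
open import Data.List.Relation.Unary.Any using (here; there)
open import Data.List.Membership.Propositional using (_∈_; _∉_)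
open import Data.List.Membership.Propositional.Properties using (∈-++⁺ˡ; ∈-++⁻; ∈-applyUpTo⁺; ∈-applyUpTo⁻)
open import Data.List.Relation.Binary.BagAndSetEquality using (_∼[_]_; set; [_]-Equality; ++-cong)
open import Data.Product using (∃; _×_; _,_; proj₁; proj₂)
open import Data.Sum using (_⊎_; inj₁; inj₂; [_,_]′)
open import Function using (_∘_; id)
open import Function.Bundles using (_↔_; Equivalence; mk⇔)
open import Function.Properties.Inverse using (↔⇒↣)
open import Relation.Nullary using (¬_; yes; no; contradiction)
open import Relation.Nullary.Decidable using (via-injection)
open import Relation.Binary using (Setoid; DecidableEquality; tri<; tri≈; tri>)
import Relation.Binary.Reasoning.Setoid as SetoidReasoning
open import Relation.Binary.PropositionalEquality using (_≡_; refl; sym; trans; cong; cong₂; subst; subst₂; module ≡-Reasoning)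

∈L⇒∈ : {A : Set} {z : A} {xs : List A} → z ∈L xs → z ∈ xs
∈L⇒∈ here      = here refl
∈L⇒∈ (there p) = there (∈L⇒∈ p)

∈⇒∈L : {A : Set} {z : A} {xs : List A} → z ∈ xs → z ∈L xs
∈⇒∈L (here refl) = here
∈⇒∈L (there p)   = there (∈⇒∈L p)

prefix≡applyUpTo : {A : Set} (x : ℕ → A) (t : ℕ) → prefix x t ≡ applyUpTo x (suc t)
prefix≡applyUpTo x zero    = refl
prefix≡applyUpTo x (suc t) = trans (cong (_∷ʳ x (suc t)) (prefix≡applyUpTo x t)) (applyUpTo-∷ʳ x (suc t))

length-<-++ : {A : Set} (xs : List A) {ys : List A} {z : A} → z ∈ xs ++ ys → z ∉ xs →
              length xs < length (xs ++ ys)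
length-<-++ {A} xs {ys} z∈xs++ys z∉xs with ∈-++⁻ xs z∈xs++ys
... | inj₁ z∈xs = contradiction z∈xs z∉xs
... | inj₂ z∈ys = subst (length xs <_) (sym (length-++ xs)) (m<m+n (length xs) (nonempty z∈ys))
  where
  nonempty : ∀ {zs} {w : A} → w ∈ zs → 0 < length zs
  nonempty (here _)  = z<s
  nonempty (there _) = z<s

nth : {A : Set} → A → List A → ℕ → A
nth d []       _       = d
nth d (a ∷ _)  zero    = a
nth d (_ ∷ as) (suc k) = nth d as k

nth-++ˡ : {A : Set} (d : A) (xs ys : List A) {k : ℕ} → k < length xs → nth d (xs ++ ys) k ≡ nth d xs k
nth-++ˡ d (a ∷ xs) ys {zero}  _           = refl
nth-++ˡ d (a ∷ xs) ys {suc k} (s<s k<∣xs∣) = nth-++ˡ d xs ys k<∣xs∣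

applyUpTo-nth : {A : Set} (d : A) (xs : List A) (f : ℕ → A) →
                (∀ {k} → k < length xs → nth d xs k ≡ f k) → xs ≡ applyUpTo f (length xs)
applyUpTo-nth d []       f agree = refl
applyUpTo-nth d (a ∷ xs) f agree = cong₂ _∷_ (agree z<s) (applyUpTo-nth d xs (f ∘ suc) (agree ∘ s<s))

fresh⇒distinct : {A : Set} (f : ℕ → A) → (∀ n → f n ∉ applyUpTo f n) → Distinct f
fresh⇒distinct f fresh i j fi≡fj with <-cmp i j
... | tri< i<j _ _ = contradiction (subst (_∈ applyUpTo f j) fi≡fj (∈-applyUpTo⁺ f i<j)) (fresh j)
... | tri≈ _ i≡j _ = i≡j
... | tri> _ _ j<i = contradiction (subst (_∈ applyUpTo f i) (sym fi≡fj) (∈-applyUpTo⁺ f j<i)) (fresh i)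

-- Discrete intermediate value theorem.
crossing : (f : ℕ → ℕ) → (∀ t → f (suc t) ≤ suc (f t)) →
           ∀ {n} t → f 0 ≤ n → n < f t → ∃ λ s → f s ≡ n × n < f (suc s)
crossing f step zero    f0≤n n<f0 = contradiction f0≤n (<⇒≱ n<f0)
crossing f step {n} (suc t) f0≤n n<f[1+t] with n <? f t
... | yes n<ft = crossing f step t f0≤n n<ft
... | no  n≮ft = t , ≤-antisym (≮⇒≥ n≮ft) (≤-pred (<-≤-trans n<f[1+t] (step t))) , n<f[1+t]

module PrefixChain {A : Set} (D : ℕ → List A) (extends : ∀ t → ∃ λ r → D (suc t) ≡ D t ++ r) where

  extends-≤′ : ∀ {t s} → t ≤′ s → ∃ λ r → D s ≡ D t ++ r
  extends-≤′ ≤′-refl = [] , sym (++-identityʳ _)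
  extends-≤′ {t} (≤′-step {s} t≤′s) =
    let r , Ds≡ = extends-≤′ t≤′s
        r′ , D[1+s]≡ = extends s
    in r ++ r′ , (begin
      D (suc s)       ≡⟨ D[1+s]≡ ⟩
      D s ++ r′        ≡⟨ cong (_++ r′) Ds≡ ⟩
      (D t ++ r) ++ r′ ≡⟨ ++-assoc (D t) r r′ ⟩
      D t ++ r ++ r′   ∎)
    where open ≡-Reasoning

  extends-≤ : ∀ {t s} → t ≤ s → ∃ λ r → D s ≡ D t ++ r
  extends-≤ = extends-≤′ ∘ ≤⇒≤′

  length-mono : ∀ {t s} → t ≤ s → length (D t) ≤ length (D s)
  length-mono {t} t≤s =
    let r , Ds≡ = extends-≤ t≤s
    in ≤-trans (m≤m+n _ _) (≤-reflexive (sym (trans (cong length Ds≡) (length-++ (D t)))))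

  nth-extends : (d : A) → ∀ {t s k} → t ≤ s → k < length (D t) → nth d (D s) k ≡ nth d (D t) k
  nth-extends d {t} t≤s k<∣Dt∣ =
    let r , Ds≡ = extends-≤ t≤s
    in trans (cong (λ l → nth d l _) Ds≡) (nth-++ˡ d (D t) r k<∣Dt∣)

  module Limit (d : A) (unbounded : ∀ k → ∃ λ t → k < length (D t)) where

    limit : ℕ → A
    limit k = nth d (D (proj₁ (unbounded k))) k

    nth-limit : ∀ {t k} → k < length (D t) → nth d (D t) k ≡ limit k
    nth-limit {t} {k} k<∣Dt∣ =
      let T , k<∣DT∣ = unbounded k
      in trans (sym (nth-extends d (m≤m⊔n t T) k<∣Dt∣)) (nth-extends d (m≤n⊔m t T) k<∣DT∣)

    D≡applyUpTo-limit : ∀ t → D t ≡ applyUpTo limit (length (D t))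
    D≡applyUpTo-limit t = applyUpTo-nth d (D t) limit nth-limit

module Deduplication {A : Set} (_≟ᴬ_ : DecidableEquality A) where
  open import Data.List.Membership.DecPropositional _≟ᴬ_ using (_∈?_)
  open SetoidReasoning ([ set ]-Equality A)
  open Setoid ([ set ]-Equality A) using (reflexive) renaming (refl to ∼-refl)

  insertNew : List A → A → List A
  insertNew xs a with a ∈? xs
  ... | yes _ = xs
  ... | no  _ = xs ∷ʳ a

  insertNew-cases : ∀ xs a → (a ∈ xs × insertNew xs a ≡ xs) ⊎ (a ∉ xs × insertNew xs a ≡ xs ∷ʳ a)
  insertNew-cases xs a with a ∈? xs
  ... | yes a∈xs = inj₁ (a∈xs , refl)
  ... | no  a∉xs = inj₂ (a∉xs , refl)

  insertNew∼∷ʳ : ∀ xs a → insertNew xs a ∼[ set ] xs ∷ʳ a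
  insertNew∼∷ʳ xs a with insertNew-cases xs a
  ... | inj₁ (a∈xs , same) rewrite same = mk⇔ ∈-++⁺ˡ ([ id , (λ { (here refl) → a∈xs }) ]′ ∘ ∈-++⁻ xs)
  ... | inj₂ (_ , appended) = reflexive appended

  nub : List A → List A
  nub = foldl insertNew []

  nub-∷ʳ : ∀ xs a → nub (xs ∷ʳ a) ≡ insertNew (nub xs) a
  nub-∷ʳ xs a = foldl-∷ʳ insertNew [] a xs

  foldl-insertNew∼++ : ∀ acc xs → foldl insertNew acc xs ∼[ set ] acc ++ xs
  foldl-insertNew∼++ acc []       = reflexive (sym (++-identityʳ acc))
  foldl-insertNew∼++ acc (a ∷ xs) = begin
    foldl insertNew (insertNew acc a) xs ≈⟨ foldl-insertNew∼++ (insertNew acc a) xs ⟩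
    insertNew acc a ++ xs                ≈⟨ ++-cong (insertNew∼∷ʳ acc a) ∼-refl ⟩
    (acc ∷ʳ a) ++ xs                     ≡⟨ ++-assoc acc [ a ] xs ⟩
    acc ++ a ∷ xs                        ∎

  nub∼ : ∀ xs → nub xs ∼[ set ] xs
  nub∼ = foldl-insertNew∼++ []

module FirstOccurrences {U : Set} (_≟ᵁ_ : DecidableEquality U) {K : Subset U} (K-infinite : Infinite K)
                        (x : ℕ → U) (x-enumerates : Enumerates K x) where
  open Deduplication _≟ᵁ_

  D : ℕ → List U
  D t = nub (applyUpTo x t)

  ∈-D⁺ : ∀ {s t} → s < t → x s ∈ D t
  ∈-D⁺ s<t = Equivalence.from (nub∼ _) (∈-applyUpTo⁺ x s<t)

  ∈-D⁻ : ∀ {z t} → z ∈ D t → ∃ λ s → s < t × z ≡ x s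
  ∈-D⁻ z∈Dt = ∈-applyUpTo⁻ x (Equivalence.to (nub∼ _) z∈Dt)

  D-suc : ∀ t → D (suc t) ≡ insertNew (D t) (x t)
  D-suc t = trans (cong nub (sym (applyUpTo-∷ʳ x t))) (nub-∷ʳ (applyUpTo x t) (x t))

  D-suc-cases : ∀ t → (x t ∈ D t × D (suc t) ≡ D t) ⊎ (x t ∉ D t × D (suc t) ≡ D t ∷ʳ x t)
  D-suc-cases t with insertNew-cases (D t) (x t)
  ... | inj₁ (x∈ , same)     = inj₁ (x∈ , trans (D-suc t) same)
  ... | inj₂ (x∉ , appended) = inj₂ (x∉ , trans (D-suc t) appended)

  D-extends : ∀ t → ∃ λ r → D (suc t) ≡ D t ++ r
  D-extends t with D-suc-cases t
  ... | inj₁ (_ , same)     = [] , trans same (sym (++-identityʳ (D t)))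
  ... | inj₂ (_ , appended) = [ x t ] , appended

  length-D-suc : ∀ t → length (D (suc t)) ≤ suc (length (D t))
  length-D-suc t with D-suc-cases t
  ... | inj₁ (_ , same)     = ≤-trans (≤-reflexive (cong length same)) (n≤1+n _)
  ... | inj₂ (_ , appended) = ≤-reflexive (trans (cong length appended) (length-++-comm (D t) [ x t ]))

  open PrefixChain D D-extends

  D-grows : ∀ t → ∃ λ s → length (D t) < length (D s)
  D-grows t =
    let z , z∈K , z∉Dt = K-infinite (D t)
        s , xs≡z = proj₂ x-enumerates z z∈K
        u = t ⊔ suc s
        r , Du≡ = extends-≤ (m≤m⊔n t (suc s))
        z∈Du = subst (_∈ D u) xs≡z (∈-D⁺ (m≤n⊔m t (suc s)))
    in u , subst (λ l → length (D t) < length l) (sym Du≡)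
                 (length-<-++ (D t) (subst (z ∈_) Du≡ z∈Du) (z∉Dt ∘ ∈⇒∈L))

  D-unbounded : ∀ k → ∃ λ t → k < length (D t)
  D-unbounded zero    = D-grows 0
  D-unbounded (suc k) =
    let t , k<∣Dt∣ = D-unbounded k
        s , ∣Dt∣<∣Ds∣ = D-grows t
    in s , <-≤-trans (s<s k<∣Dt∣) ∣Dt∣<∣Ds∣

  open Limit (x 0) D-unbounded public renaming (limit to y; D≡applyUpTo-limit to D≡applyUpTo-y)

  -- y n is the element appended at the step where the chain grows past length n.
  y-fresh : ∀ n → y n ∉ applyUpTo y n
  y-fresh n with crossing (length ∘ D) length-D-suc (proj₁ (D-unbounded n)) z≤n (proj₂ (D-unbounded n))
  ... | s , ∣Ds∣≡n , n<∣D[1+s]∣ with D-suc-cases s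
  ...   | inj₁ (_ , same) = contradiction (subst (n <_) (trans (cong length same) ∣Ds∣≡n) n<∣D[1+s]∣) (<-irrefl refl)
  ...   | inj₂ (xs∉Ds , appended) = subst₂ _∉_ xs≡yn Ds≡ xs∉Ds
    where
    ∣D[1+s]∣≡ : length (D (suc s)) ≡ suc n
    ∣D[1+s]∣≡ = trans (cong length appended) (trans (length-++-comm (D s) [ x s ]) (cong suc ∣Ds∣≡n))

    open ≡-Reasoning
    snoc≡ : D s ∷ʳ x s ≡ applyUpTo y n ∷ʳ y n
    snoc≡ = begin
      D s ∷ʳ x s                       ≡⟨ sym appended ⟩
      D (suc s)                        ≡⟨ D≡applyUpTo-y (suc s) ⟩
      applyUpTo y (length (D (suc s))) ≡⟨ cong (applyUpTo y) ∣D[1+s]∣≡ ⟩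
      applyUpTo y (suc n)              ≡⟨ sym (applyUpTo-∷ʳ y n) ⟩
      applyUpTo y n ∷ʳ y n             ∎

    Ds≡ : D s ≡ applyUpTo y n
    Ds≡ = proj₁ (∷ʳ-injective (D s) (applyUpTo y n) snoc≡)

    xs≡yn : x s ≡ y n
    xs≡yn = proj₂ (∷ʳ-injective (D s) (applyUpTo y n) snoc≡)

  y-distinct : Distinct y
  y-distinct = fresh⇒distinct y y-fresh

  y-enumerates : Enumerates K y
  y-enumerates = y∈K , onto
    where
    y∈K : ∀ k → K (y k)
    y∈K k =
      let t , k<∣Dt∣ = D-unbounded k
          _ , _ , yk≡xs = ∈-D⁻ {t = t} (subst (y k ∈_) (sym (D≡applyUpTo-y t)) (∈-applyUpTo⁺ y k<∣Dt∣))
      in subst K (sym yk≡xs) (proj₁ x-enumerates _)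

    onto : ∀ z → K z → ∃ λ k → y k ≡ z
    onto z z∈K =
      let s , xs≡z = proj₂ x-enumerates z z∈K
          k , _ , xs≡yk = ∈-applyUpTo⁻ y (subst (x s ∈_) (D≡applyUpTo-y (suc s)) (∈-D⁺ (n<1+n s)))
      in k , trans (sym xs≡yk) xs≡z

  nub-prefix : ∀ t → ∃ λ m → length (D (suc t)) ≡ suc m × nub (prefix x t) ≡ prefix y m
  nub-prefix t with length (D (suc t)) | D≡applyUpTo-y (suc t)
  ... | zero  | D[1+t]≡[] = contradiction (subst (x t ∈_) D[1+t]≡[] (∈-D⁺ (n<1+n t))) λ ()
  ... | suc m | D[1+t]≡   = m , refl , (begin
    nub (prefix x t)    ≡⟨ cong nub (prefix≡applyUpTo x t) ⟩
    D (suc t)           ≡⟨ D[1+t]≡ ⟩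
    applyUpTo y (suc m) ≡⟨ sym (prefix≡applyUpTo y m) ⟩
    prefix y m          ∎)
    where open ≡-Reasoning

  generates-transfer : (G : Generator U) → EventuallyGenerates G K y → EventuallyGenerates (G ∘ nub) K x
  generates-transfer G (t⋆ , works) = proj₁ (D-unbounded t⋆) , eventually
    where
    eventually : ∀ t → t ≥ proj₁ (D-unbounded t⋆) →
                 K (G (nub (prefix x t))) × ¬ (G (nub (prefix x t)) ∈L prefix x t)
    eventually t t≥t₀ with nub-prefix t
    ... | m , ∣D[1+t]∣≡ , nub≡ with works m t⋆≤m
      where
      t⋆≤m : t⋆ ≤ m
      t⋆≤m = ≤-pred (≤-trans (<-≤-trans (proj₂ (D-unbounded t⋆)) (length-mono (≤-trans t≥t₀ (n≤1+n t))))
                             (≤-reflexive ∣D[1+t]∣≡))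
    ... | Gy∈K , Gy∉ = subst (K ∘ G) (sym nub≡) Gy∈K
                     , λ Gx∈ → Gy∉ (∈⇒∈L (subst (λ l → G l ∈ l) nub≡
                                             (Equivalence.from (nub∼ _) (∈L⇒∈ Gx∈))))

lemmaA3 : (U : Set) → U ↔ ℕ → (C : Collection U) → IsCollectionOfLanguages C →
          GeneratableWithoutRepetition C → GeneratableWithRepetitions C
lemmaA3 U U↔ℕ C languages (G , G-generates) = G ∘ nub , generates
  where
  _≟ᵁ_ : DecidableEquality U
  _≟ᵁ_ = via-injection (↔⇒↣ U↔ℕ) _≟_

  open Deduplication _≟ᵁ_ using (nub)

  generates : (K : Subset U) → C K → (x : ℕ → U) → Enumerates K x → EventuallyGenerates (G ∘ nub) K x
  generates K K∈C x x-enumerates =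
    generates-transfer G (G-generates K K∈C y y-distinct y-enumerates)
    where open FirstOccurrences _≟ᵁ_ (languages K K∈C) x x-enumerates
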